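{- Let $P\subset\mathbb{R}^3$ be a lattice polytope with $\Delta_P(x)=l_1\leq\Delta_P(y)=l_2\leq\Delta_P(z)=l$. Suppose that $\Delta_P(mx+ny+z)\geq l$ for all $m,n\in\mathbb{Z}$. Then $\Delta_P(ax+by+cz)\geq l$ for all primitive directions $(a,b,c)\in\mathbb{Z}^3$ with $c\neq0$, except possibly for directions with $|a|=|b|=1$ and $|c|=2$.
   Context: A lattice polytope is the convex hull of finitely many points of $\mathbb{Z}^3$. For a linear function $f=ax+by+cz$ with $a,b,c\in\mathbb{Z}$, $\Delta_P(f)=\max_{p\in P}f(p)-\min_{p\in P}f(p)$. A direction $(a,b,c)\in\mathbb{Z}^3$ is primitive if $\gcd(a,b,c)=1$. -}

module Defs where

open import Data.Integer using (ℤ; +_; _+_; _*_; _-_; _⊔_; _⊓_; ∣_∣)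
open import Data.Nat using (ℕ)
open import Data.Nat.GCD using (gcd)
open import Data.List using (List; foldr)
open import Data.Product using (_×_; _,_)
open import Relation.Binary.PropositionalEquality using (_≡_)

Point : Set
Point = ℤ × ℤ × ℤ

-- A lattice polytope P = conv(S) for a finite nonempty set S ⊂ ℤ³,
-- represented by its generating points: a first point and a list of others.
record LatticePolytope : Set where
  constructor conv
  field
    first : Point
    rest  : List Point

-- A linear functional f = a x + b y + c z with integer coefficients,
-- given by its coefficient vector.
Dir : Set
Dir = ℤ × ℤ × ℤ

eval : Dir → Point → ℤ
eval (a , b , c) (x , y , z) = a * x + b * y + c * z

-- max / min of f over P = conv(S).  A linear function attains its max and
-- min over the convex hull of S at points of S, so these are max/min over S.
maxOn : LatticePolytope → Dir → ℤ
maxOn (conv p ps) f = foldr (λ q m → eval f q ⊔ m) (eval f p) ps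

minOn : LatticePolytope → Dir → ℤ
minOn (conv p ps) f = foldr (λ q m → eval f q ⊓ m) (eval f p) ps

Δ : LatticePolytope → Dir → ℤ
Δ P f = maxOn P f - minOn P f

Primitive : Dir → Set
Primitive (a , b , c) = gcd (gcd ∣ a ∣ ∣ b ∣) ∣ c ∣ ≡ 1

-- Let L = Δ_P(z) and, after replacing (a, b, c) by its negative, c > 0 (Δ_P(-f) = Δ_P(f)).
-- Round a/c and b/c to nearest integers m, n, so that r₁ = |cm - a| and r₂ = |cn - b| are at
-- most c/2, and pick p, q ∈ P realising Δ_P(mx + ny + z) ≥ L.  The chord d = p - q has
-- |d_x|, |d_y| ≤ L, and
--   cL ≤ c (m d_x + n d_y + d_z) = (cm - a) d_x + (cn - b) d_y + (a, b, c)·d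
--      ≤ (r₁ + r₂) L + Δ_P(a, b, c),
-- which proves the claim unless r₁ = r₂ = c/2.  Then c/2 divides a, b and c, so primitivity
-- forces c = 2 and a = ±(2M + 1), b = ±(2N + 1).  Rounding instead to (±M, ±N, 1) gives
-- 2L + U + V ≤ Δ_P(a, b, 2) for the signed coordinates U = ±d_x, V = ±d_y, and this suffices
-- unless U, V < 0; but then L ≤ MU + NV + d_z < L as soon as M + N > 0, that is, as soon as
-- (a, b, c) is not one of the exceptional directions (±1, ±1, ±2).

module Submission where

open import Defs
open import Data.Integer.Base
  using (ℤ; +_; -[1+_]; +[1+_]; 0ℤ; 1ℤ; -1ℤ; _+_; _*_; _-_; -_; _≤_; ∣_∣;
         +≤+; -≤+; -≤-; pred; nonNegative; _%ℕ_; _/ℕ_)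
open import Data.Integer.Properties
  using (≤-refl; ≤-reflexive; ≤-trans; +-mono-≤; +-monoˡ-≤; +-monoʳ-≤; *-monoˡ-≤-nonNeg;
         *-monoʳ-≤-nonNeg; neg-mono-≤; neg-≤-pos; i≤pred[j]⇒i<j; neg-distrib-+;
         +∣i∣≡i⊎+∣i∣≡-i; ∣-i∣≡∣i∣; abs-*; pos-*; *-identityˡ; -1*i≡-i; *-comm;
         ⊔-sel; ⊓-sel; i≤i⊔j; i≤j⇒i≤k⊔j; i⊓j≤i; i≤j⇒k⊓i≤j; module ≤-Reasoning)
open import Data.Integer.DivMod using (a≡a%ℕn+[a/ℕn]*n; n%ℕd<d)
open import Data.Integer.Divisibility.Signed
  using (∣m∣∣m; ∣-refl; ∣m∣n⇒∣m+n; ∣m∣n⇒∣m-n; ∣m⇒∣m*n; ∣⇒∣ᵤ) renaming (_∣_ to _∣ℤ_)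
open import Data.Integer.Tactic.RingSolver using (solve-∀; solve)
open import Data.Nat.Base as ℕ using (ℕ; suc; z≤n; NonZero)
import Data.Nat.Properties as ℕ
open import Data.Nat.Divisibility using (_∣_; ∣1⇒≡1)
import Data.Nat.Divisibility as ℕ
open import Data.Nat.GCD using (gcd; gcd-greatest)
open import Data.List using (List; []; _∷_)
open import Data.List.Membership.Propositional using (_∈_)
open import Data.List.Relation.Unary.Any using (here; there)
open import Data.Product using (∃; ∃₂; _×_; _,_)
open import Data.Sum using (_⊎_; inj₁; inj₂)
open import Data.Empty using (⊥-elim)
open import Function using (_∘_)
open import Relation.Nullary using (¬_; yes; no)
open import Relation.Binary.PropositionalEquality
  using (_≡_; _≢_; refl; sym; trans; cong; cong₂; subst)

i≤+∣i∣ : ∀ i → i ≤ + ∣ i ∣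
i≤+∣i∣ (+ n)    = ≤-refl
i≤+∣i∣ -[1+ n ] = -≤+

∣i∣≤j⇒-j≤i : ∀ {i j} → + ∣ i ∣ ≤ j → - j ≤ i
∣i∣≤j⇒-j≤i {+ n}      ∣i∣≤j = ≤-trans (neg-mono-≤ ∣i∣≤j) neg-≤-pos
∣i∣≤j⇒-j≤i { -[1+ n ]} ∣i∣≤j = neg-mono-≤ ∣i∣≤j

+-cancelˡ-≤ : ∀ k {i j} → k + i ≤ k + j → i ≤ j
+-cancelˡ-≤ k {i} {j} k+i≤k+j = begin
  i              ≡⟨ solve (k ∷ i ∷ []) ⟩
  - k + (k + i)  ≤⟨ +-monoʳ-≤ (- k) k+i≤k+j ⟩
  - k + (k + j)  ≡⟨ solve (k ∷ j ∷ []) ⟩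
  j              ∎
  where open ≤-Reasoning

∣j∣≤k⇒i*j≤∣i∣*k : ∀ i {j k} → + ∣ j ∣ ≤ k → i * j ≤ + ∣ i ∣ * k
∣j∣≤k⇒i*j≤∣i∣*k i {j} {k} ∣j∣≤k = begin
  i * j                ≤⟨ i≤+∣i∣ (i * j) ⟩
  + ∣ i * j ∣          ≡⟨ cong +_ (abs-* i j) ⟩
  + (∣ i ∣ ℕ.* ∣ j ∣)  ≡⟨ pos-* ∣ i ∣ ∣ j ∣ ⟩
  + ∣ i ∣ * + ∣ j ∣    ≤⟨ *-monoˡ-≤-nonNeg (+ ∣ i ∣) ∣j∣≤k ⟩
  + ∣ i ∣ * k          ∎
  where open ≤-Reasoning

+m*-[1+n]≤-m : ∀ m n → + m * -[1+ n ] ≤ - + m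
+m*-[1+n]≤-m m n = begin
  + m * -[1+ n ]  ≤⟨ *-monoˡ-≤-nonNeg (+ m) (-≤- z≤n) ⟩
  + m * -1ℤ       ≡⟨ *-comm (+ m) -1ℤ ⟩
  -1ℤ * + m       ≡⟨ -1*i≡-i (+ m) ⟩
  - + m           ∎
  where open ≤-Reasoning

IsUnit : ℤ → Set
IsUnit ε = ε ≡ 1ℤ ⊎ ε ≡ -1ℤ

∣i∣≡1⇒IsUnit : ∀ {i} → ∣ i ∣ ≡ 1 → IsUnit i
∣i∣≡1⇒IsUnit {+ .1}      refl = inj₁ refl
∣i∣≡1⇒IsUnit { -[1+ 0 ]} refl = inj₂ refl

∣ε*i∣≡∣i∣ : ∀ {ε} → IsUnit ε → ∀ i → ∣ ε * i ∣ ≡ ∣ i ∣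
∣ε*i∣≡∣i∣ (inj₁ refl) i = cong ∣_∣ (*-identityˡ i)
∣ε*i∣≡∣i∣ (inj₂ refl) i = trans (cong ∣_∣ (-1*i≡-i i)) (∣-i∣≡∣i∣ i)

data SignedOdd : ℤ → Set where
  signedOdd : ∀ {ε} → IsUnit ε → (M : ℕ) → SignedOdd (ε * (+ 2 * + M + + 1))

2k+1-signedOdd : ∀ k → SignedOdd (+ 2 * k + + 1)
2k+1-signedOdd (+ M)    = subst SignedOdd (*-identityˡ _) (signedOdd (inj₁ refl) M)
2k+1-signedOdd -[1+ M ] = subst SignedOdd (flip (+ M)) (signedOdd (inj₂ refl) M)
  where
  flip : ∀ M → -1ℤ * (+ 2 * M + + 1) ≡ + 2 * - (+ 1 + M) + + 1
  flip = solve-∀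

2m-ε-signedOdd : ∀ m {ε} → IsUnit ε → SignedOdd (+ 2 * m - ε)
2m-ε-signedOdd m (inj₁ refl) = subst SignedOdd (lower m) (2k+1-signedOdd (m - + 1))
  where
  lower : ∀ m → + 2 * (m - + 1) + + 1 ≡ + 2 * m - + 1
  lower = solve-∀
2m-ε-signedOdd m (inj₂ refl) = subst SignedOdd (raise m) (2k+1-signedOdd m)
  where
  raise : ∀ m → + 2 * m + + 1 ≡ + 2 * m - - + 1
  raise = solve-∀

∣2m-a∣≡1⇒signedOdd : ∀ m a → ∣ + 2 * m - a ∣ ≡ 1 → SignedOdd a
∣2m-a∣≡1⇒signedOdd m a ∣2m-a∣≡1 =
  subst SignedOdd (cancel m a) (2m-ε-signedOdd m (∣i∣≡1⇒IsUnit ∣2m-a∣≡1))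
  where
  cancel : ∀ m a → + 2 * m - (+ 2 * m - a) ≡ a
  cancel = solve-∀

¬units⇒0<M+N : ∀ {ε₁ ε₂} → IsUnit ε₁ → IsUnit ε₂ → ∀ M N →
  ¬ (∣ ε₁ * (+ 2 * + M + + 1) ∣ ≡ 1 × ∣ ε₂ * (+ 2 * + N + + 1) ∣ ≡ 1) → 0 ℕ.< M ℕ.+ N
¬units⇒0<M+N _       _       (suc M) N       _      = ℕ.z<s
¬units⇒0<M+N _       _       0       (suc N) _      = ℕ.z<s
¬units⇒0<M+N ε₁-unit ε₂-unit 0       0       ¬units =
  ⊥-elim (¬units (∣ε*i∣≡∣i∣ ε₁-unit (+ 1) , ∣ε*i∣≡∣i∣ ε₂-unit (+ 1)))

nearest-multiple : ∀ a c .{{_ : NonZero c}} →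
  ∃₂ λ m r → ∣ + c * m - a ∣ ≡ r × r ℕ.+ r ℕ.≤ c
nearest-multiple a c with a /ℕ c | a %ℕ c | a≡a%ℕn+[a/ℕn]*n a c | n%ℕd<d a c
... | q | r | refl | r<c with r ℕ.+ r ℕ.≤? c
...   | yes r+r≤c = q , r , trans (cong ∣_∣ (round-down (+ c) q (+ r))) (∣-i∣≡∣i∣ (+ r)) , r+r≤c
  where
  round-down : ∀ c q r → c * q - (r + q * c) ≡ - r
  round-down = solve-∀
...   | no r+r≰c with ℕ.m≤n⇒∃[o]m+o≡n (ℕ.<⇒≤ r<c)
...     | s , refl = q + + 1 , s , cong ∣_∣ (round-up (+ r) (+ s) q) , s+s≤r+s
  where
  round-up : ∀ r s q → (r + s) * (q + + 1) - (r + q * (r + s)) ≡ s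
  round-up = solve-∀
  s+s≤r+s : s ℕ.+ s ℕ.≤ r ℕ.+ s
  s+s≤r+s = ℕ.+-monoˡ-≤ s (ℕ.<⇒≤ (ℕ.+-cancelˡ-< r s r (ℕ.≰⇒> r+r≰c)))

balanced-rounding : ∀ {c r₁ r₂} → r₁ ℕ.+ r₁ ℕ.≤ c → r₂ ℕ.+ r₂ ℕ.≤ c → c ℕ.≤ r₁ ℕ.+ r₂ →
  r₂ ≡ r₁ × c ≡ r₁ ℕ.+ r₁
balanced-rounding {c} {r₁} {r₂} 2r₁≤c 2r₂≤c c≤r₁+r₂ = r₂≡r₁ , ℕ.≤-antisym c≤2r₁ 2r₁≤c
  where
  r₂≡r₁ : r₂ ≡ r₁
  r₂≡r₁ = ℕ.≤-antisym (ℕ.+-cancelʳ-≤ r₂ r₂ r₁ (ℕ.≤-trans 2r₂≤c c≤r₁+r₂))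
                      (ℕ.+-cancelˡ-≤ r₁ r₁ r₂ (ℕ.≤-trans 2r₁≤c c≤r₁+r₂))
  c≤2r₁ : c ℕ.≤ r₁ ℕ.+ r₁
  c≤2r₁ = subst (λ k → c ℕ.≤ r₁ ℕ.+ k) r₂≡r₁ c≤r₁+r₂

∣2r*m-a∣≡r⇒r∣a : ∀ {r} m a → ∣ + (r ℕ.+ r) * m - a ∣ ≡ r → r ∣ ∣ a ∣
∣2r*m-a∣≡r⇒r∣a {r} m a ∣2rm-a∣≡r =
  ∣⇒∣ᵤ (subst (+ r ∣ℤ_) (cancel (+ (r ℕ.+ r) * m) a) (∣m∣n⇒∣m-n r∣2rm r∣2rm-a))
  where
  cancel : ∀ x a → x - (x - a) ≡ a
  cancel = solve-∀
  r∣2rm : + r ∣ℤ + (r ℕ.+ r) * m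
  r∣2rm = ∣m⇒∣m*n m (∣m∣n⇒∣m+n ∣-refl ∣-refl)
  r∣2rm-a : + r ∣ℤ + (r ℕ.+ r) * m - a
  r∣2rm-a = subst (λ k → + k ∣ℤ + (r ℕ.+ r) * m - a) ∣2rm-a∣≡r ∣m∣∣m

balanced-primitive⇒r≡1 : ∀ {r} m n a b →
  ∣ + (r ℕ.+ r) * m - a ∣ ≡ r → ∣ + (r ℕ.+ r) * n - b ∣ ≡ r →
  Primitive (a , b , + (r ℕ.+ r)) → r ≡ 1
balanced-primitive⇒r≡1 m n a b dist₁ dist₂ prim = ∣1⇒≡1 (subst (_ ∣_) prim
  (gcd-greatest (gcd-greatest (∣2r*m-a∣≡r⇒r∣a m a dist₁) (∣2r*m-a∣≡r⇒r∣a n b dist₂))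
                (ℕ.∣m∣n⇒∣m+n ℕ.∣-refl ℕ.∣-refl)))

rounding-bound : ∀ {c r₁ r₂ : ℕ} {a b m n X Y Z L F : ℤ} →
  ∣ + c * m - a ∣ ≡ r₁ → ∣ + c * n - b ∣ ≡ r₂ → r₁ ℕ.+ r₂ ℕ.< c →
  + ∣ X ∣ ≤ L → + ∣ Y ∣ ≤ L → L ≤ m * X + n * Y + Z →
  a * X + b * Y + + c * Z ≤ F → L ≤ F
rounding-bound {c} {r₁} {r₂} {a} {b} {m} {n} {X} {Y} {Z} {L} {F}
               dist₁ dist₂ r₁+r₂<c ∣X∣≤L ∣Y∣≤L L≤span f≤F =
  +-cancelˡ-≤ (+ r₁ * L + + r₂ * L) (begin
    + r₁ * L + + r₂ * L + L    ≡⟨ count (+ r₁) (+ r₂) L ⟩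
    + suc (r₁ ℕ.+ r₂) * L      ≤⟨ *-monoʳ-≤-nonNeg L {{nonNegative 0≤L}} (+≤+ r₁+r₂<c) ⟩
    + c * L                    ≤⟨ *-monoˡ-≤-nonNeg (+ c) L≤span ⟩
    + c * (m * X + n * Y + Z)  ≡⟨ regroup (+ c) a b m n X Y Z ⟩
    (+ c * m - a) * X + (+ c * n - b) * Y + (a * X + b * Y + + c * Z)
      ≤⟨ +-mono-≤ (+-mono-≤ (bound (+ c * m - a) dist₁ ∣X∣≤L)
                            (bound (+ c * n - b) dist₂ ∣Y∣≤L)) f≤F ⟩
    + r₁ * L + + r₂ * L + F    ∎)
  where
  open ≤-Reasoning
  0≤L : 0ℤ ≤ L
  0≤L = ≤-trans (+≤+ z≤n) ∣X∣≤L
  bound : ∀ u {X r} → ∣ u ∣ ≡ r → + ∣ X ∣ ≤ L → u * X ≤ + r * L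
  bound u refl = ∣j∣≤k⇒i*j≤∣i∣*k u
  count : ∀ r₁ r₂ L → r₁ * L + r₂ * L + L ≡ (+ 1 + (r₁ + r₂)) * L
  count = solve-∀
  regroup : ∀ c a b m n X Y Z →
    c * (m * X + n * Y + Z) ≡ (c * m - a) * X + (c * n - b) * Y + (a * X + b * Y + c * Z)
  regroup = solve-∀

L+L+U+V≤F : ∀ M N U V {Z L F} → L ≤ M * U + N * V + Z →
  (+ 2 * M + + 1) * U + (+ 2 * N + + 1) * V + + 2 * Z ≤ F → L + L + U + V ≤ F
L+L+U+V≤F M N U V {Z} {L} {F} L≤span f≤F = begin
  L + L + U + V
    ≤⟨ +-monoˡ-≤ V (+-monoˡ-≤ U (+-mono-≤ L≤span L≤span)) ⟩
  (M * U + N * V + Z) + (M * U + N * V + Z) + U + V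
    ≡⟨ solve (M ∷ N ∷ U ∷ V ∷ Z ∷ []) ⟩
  (+ 2 * M + + 1) * U + (+ 2 * N + + 1) * V + + 2 * Z
    ≤⟨ f≤F ⟩
  F ∎
  where open ≤-Reasoning

L+L+U+V≤F⇒L≤F : ∀ {L U V F} → 0ℤ ≤ U → + ∣ V ∣ ≤ L → L + L + U + V ≤ F → L ≤ F
L+L+U+V≤F⇒L≤F {L} {U} {V} {F} 0≤U ∣V∣≤L sum≤F = begin
  L                 ≡⟨ solve (L ∷ []) ⟩
  L + L + 0ℤ + - L  ≤⟨ +-mono-≤ (+-monoʳ-≤ (L + L) 0≤U) (∣i∣≤j⇒-j≤i ∣V∣≤L) ⟩
  L + L + U + V     ≤⟨ sum≤F ⟩
  F                 ∎
  where open ≤-Reasoning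

odd-bound : ∀ {M N : ℕ} {U V Z L F : ℤ} → 0 ℕ.< M ℕ.+ N →
  + ∣ U ∣ ≤ L → + ∣ V ∣ ≤ L → Z ≤ L → L ≤ + M * U + + N * V + Z →
  (+ 2 * + M + + 1) * U + (+ 2 * + N + + 1) * V + + 2 * Z ≤ F → L ≤ F
odd-bound {M} {N} {+ u} {V} _ _ ∣V∣≤L _ L≤span f≤F =
  L+L+U+V≤F⇒L≤F (+≤+ z≤n) ∣V∣≤L (L+L+U+V≤F (+ M) (+ N) (+ u) V L≤span f≤F)
odd-bound {M} {N} { -[1+ u ]} {+ v} {L = L} _ ∣U∣≤L _ _ L≤span f≤F =
  L+L+U+V≤F⇒L≤F (+≤+ z≤n) ∣U∣≤L (≤-trans (≤-reflexive (swap L -[1+ u ] (+ v)))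
                                      (L+L+U+V≤F (+ M) (+ N) -[1+ u ] (+ v) L≤span f≤F))
  where
  swap : ∀ L U V → L + L + V + U ≡ L + L + U + V
  swap = solve-∀
odd-bound {M} {N} { -[1+ u ]} { -[1+ v ]} {Z} {L} 0<M+N _ _ Z≤L L≤span _ = begin-contradiction
  L                                    ≤⟨ L≤span ⟩
  + M * -[1+ u ] + + N * -[1+ v ] + Z  ≤⟨ +-mono-≤ (+-mono-≤ (+m*-[1+n]≤-m M u) (+m*-[1+n]≤-m N v)) Z≤L ⟩
  - + M + - + N + L                    ≡⟨ cong (_+ L) (neg-distrib-+ (+ M) (+ N)) ⟨
  - + (M ℕ.+ N) + L                    ≤⟨ +-monoˡ-≤ L (neg-mono-≤ (+≤+ 0<M+N)) ⟩
  pred L                               <⟨ i≤pred[j]⇒i<j ≤-refl ⟩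
  L                                    ∎
  where open ≤-Reasoning

points : LatticePolytope → List Point
points (conv p ps) = p ∷ ps

∈-skip : ∀ {q p y : Point} {ys} → q ∈ p ∷ ys → q ∈ p ∷ y ∷ ys
∈-skip (here q≡p) = here q≡p
∈-skip (there q∈) = there (there q∈)

eval-≤-maxOn : ∀ P f {q} → q ∈ points P → eval f q ≤ maxOn P f
eval-≤-maxOn (conv p [])       f (here refl)         = ≤-refl
eval-≤-maxOn (conv p (y ∷ ys)) f (there (here refl)) = i≤i⊔j (eval f y) _
eval-≤-maxOn (conv p (y ∷ ys)) f (here refl)         =
  i≤j⇒i≤k⊔j (eval f y) (eval-≤-maxOn (conv p ys) f (here refl))
eval-≤-maxOn (conv p (y ∷ ys)) f (there (there q∈))  =
  i≤j⇒i≤k⊔j (eval f y) (eval-≤-maxOn (conv p ys) f (there q∈))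

minOn-≤-eval : ∀ P f {q} → q ∈ points P → minOn P f ≤ eval f q
minOn-≤-eval (conv p [])       f (here refl)         = ≤-refl
minOn-≤-eval (conv p (y ∷ ys)) f (there (here refl)) = i⊓j≤i (eval f y) _
minOn-≤-eval (conv p (y ∷ ys)) f (here refl)         =
  i≤j⇒k⊓i≤j (eval f y) (minOn-≤-eval (conv p ys) f (here refl))
minOn-≤-eval (conv p (y ∷ ys)) f (there (there q∈))  =
  i≤j⇒k⊓i≤j (eval f y) (minOn-≤-eval (conv p ys) f (there q∈))

maxOn-attained : ∀ P f → ∃ λ q → q ∈ points P × eval f q ≡ maxOn P f
maxOn-attained (conv p [])       f = p , here refl , refl
maxOn-attained (conv p (y ∷ ys)) f
  with ⊔-sel (eval f y) (maxOn (conv p ys) f) | maxOn-attained (conv p ys) f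
... | inj₁ y-wins | _              = y , there (here refl) , sym y-wins
... | inj₂ ys-win | q , q∈ , q-max = q , ∈-skip q∈ , trans q-max (sym ys-win)

minOn-attained : ∀ P f → ∃ λ q → q ∈ points P × eval f q ≡ minOn P f
minOn-attained (conv p [])       f = p , here refl , refl
minOn-attained (conv p (y ∷ ys)) f
  with ⊓-sel (eval f y) (minOn (conv p ys) f) | minOn-attained (conv p ys) f
... | inj₁ y-wins | _              = y , there (here refl) , sym y-wins
... | inj₂ ys-win | q , q∈ , q-min = q , ∈-skip q∈ , trans q-min (sym ys-win)

_-ₚ_ : Point → Point → Point
(x , y , z) -ₚ (x′ , y′ , z′) = x - x′ , y - y′ , z - z′

negate : Dir → Dir
negate (a , b , c) = - a , - b , - c

eval-linear : ∀ f p q → eval f (p -ₚ q) ≡ eval f p - eval f q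
eval-linear (a , b , c) (x , y , z) (x′ , y′ , z′) = distrib a b c x y z x′ y′ z′
  where
  distrib : ∀ a b c x y z x′ y′ z′ →
    a * (x - x′) + b * (y - y′) + c * (z - z′) ≡ (a * x + b * y + c * z) - (a * x′ + b * y′ + c * z′)
  distrib = solve-∀

eval-flip : ∀ f p q → eval f (q -ₚ p) ≡ - eval f (p -ₚ q)
eval-flip (a , b , c) (x , y , z) (x′ , y′ , z′) = flip a b c x y z x′ y′ z′
  where
  flip : ∀ a b c x y z x′ y′ z′ →
    a * (x′ - x) + b * (y′ - y) + c * (z′ - z) ≡ - (a * (x - x′) + b * (y - y′) + c * (z - z′))
  flip = solve-∀

eval-negate : ∀ f d → eval (negate f) d ≡ - eval f d
eval-negate (a , b , c) (x , y , z) = neg a b c x y z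
  where
  neg : ∀ a b c x y z → - a * x + - b * y + - c * z ≡ - (a * x + b * y + c * z)
  neg = solve-∀

data Chord (P : LatticePolytope) : Point → Set where
  chord : ∀ {p q} → p ∈ points P → q ∈ points P → Chord P (p -ₚ q)

eval-≤-Δ : ∀ {P d} f → Chord P d → eval f d ≤ Δ P f
eval-≤-Δ {P} f (chord {p} {q} p∈ q∈) = begin
  eval f (p -ₚ q)          ≡⟨ eval-linear f p q ⟩
  eval f p - eval f q      ≤⟨ +-mono-≤ (eval-≤-maxOn P f p∈) (neg-mono-≤ (minOn-≤-eval P f q∈)) ⟩
  maxOn P f - minOn P f    ∎
  where open ≤-Reasoning

∣eval∣-≤-Δ : ∀ {P d} f → Chord P d → + ∣ eval f d ∣ ≤ Δ P f
∣eval∣-≤-Δ {P} f (chord {p} {q} p∈ q∈) with +∣i∣≡i⊎+∣i∣≡-i (eval f (p -ₚ q))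
... | inj₁ ∣e∣≡e  = subst (_≤ Δ P f) (sym ∣e∣≡e) (eval-≤-Δ f (chord p∈ q∈))
... | inj₂ ∣e∣≡-e = subst (_≤ Δ P f) (trans (eval-flip f p q) (sym ∣e∣≡-e)) (eval-≤-Δ f (chord q∈ p∈))

Δ-attained : ∀ P f → ∃ λ d → Chord P d × eval f d ≡ Δ P f
Δ-attained P f with maxOn-attained P f | minOn-attained P f
... | p , p∈ , p-max | q , q∈ , q-min =
  p -ₚ q , chord p∈ q∈ , trans (eval-linear f p q) (cong₂ _-_ p-max q-min)

Δ-negate-≤ : ∀ P f → Δ P (negate f) ≤ Δ P f
Δ-negate-≤ P f with Δ-attained P (negate f)
... | d , d-chord , d-attains = begin
  Δ P (negate f)       ≡⟨ d-attains ⟨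
  eval (negate f) d    ≡⟨ eval-negate f d ⟩
  - eval f d           ≤⟨ i≤+∣i∣ (- eval f d) ⟩
  + ∣ - eval f d ∣     ≡⟨ cong +_ (∣-i∣≡∣i∣ (eval f d)) ⟩
  + ∣ eval f d ∣       ≤⟨ ∣eval∣-≤-Δ f d-chord ⟩
  Δ P f                ∎
  where open ≤-Reasoning

x̂ ŷ ẑ : Dir
x̂ = + 1 , + 0 , + 0
ŷ = + 0 , + 1 , + 0
ẑ = + 0 , + 0 , + 1

eval-x̂ : ∀ X Y Z → eval x̂ (X , Y , Z) ≡ X
eval-x̂ X Y Z = unit-x X Y Z
  where
  unit-x : ∀ X Y Z → + 1 * X + + 0 * Y + + 0 * Z ≡ X
  unit-x = solve-∀

eval-ŷ : ∀ X Y Z → eval ŷ (X , Y , Z) ≡ Y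
eval-ŷ X Y Z = unit-y X Y Z
  where
  unit-y : ∀ X Y Z → + 0 * X + + 1 * Y + + 0 * Z ≡ Y
  unit-y = solve-∀

eval-ẑ : ∀ X Y Z → eval ẑ (X , Y , Z) ≡ Z
eval-ẑ X Y Z = unit-z X Y Z
  where
  unit-z : ∀ X Y Z → + 0 * X + + 0 * Y + + 1 * Z ≡ Z
  unit-z = solve-∀

Exceptional : Dir → Set
Exceptional (a , b , c) = ∣ a ∣ ≡ 1 × ∣ b ∣ ≡ 1 × ∣ c ∣ ≡ 2

Exceptional-negate : ∀ f → Exceptional (negate f) → Exceptional f
Exceptional-negate (a , b , c) (∣-a∣≡1 , ∣-b∣≡1 , ∣-c∣≡2) =
  trans (sym (∣-i∣≡∣i∣ a)) ∣-a∣≡1 ,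
  trans (sym (∣-i∣≡∣i∣ b)) ∣-b∣≡1 ,
  trans (sym (∣-i∣≡∣i∣ c)) ∣-c∣≡2

Primitive-negate : ∀ f → Primitive f → Primitive (negate f)
Primitive-negate (a , b , c) prim rewrite ∣-i∣≡∣i∣ a | ∣-i∣≡∣i∣ b | ∣-i∣≡∣i∣ c = prim

module _ (P : LatticePolytope) (Δx≤Δz : Δ P x̂ ≤ Δ P ẑ) (Δy≤Δz : Δ P ŷ ≤ Δ P ẑ)
         (Δz≤Δ[m,n,1] : ∀ m n → Δ P ẑ ≤ Δ P (m , n , + 1)) where

  record WidestChord (m n : ℤ) : Set where
    field
      X Y Z   : ℤ
      ∣X∣≤Δz  : + ∣ X ∣ ≤ Δ P ẑ
      ∣Y∣≤Δz  : + ∣ Y ∣ ≤ Δ P ẑ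
      Z≤Δz    : Z ≤ Δ P ẑ
      Δz≤span : Δ P ẑ ≤ m * X + n * Y + Z
      eval≤Δ  : ∀ f → eval f (X , Y , Z) ≤ Δ P f

  widestChord : ∀ m n → WidestChord m n
  widestChord m n with Δ-attained P (m , n , + 1)
  ... | (X , Y , Z) , d-chord , d-attains = record
    { X = X ; Y = Y ; Z = Z
    ; ∣X∣≤Δz  = ≤-trans (subst (λ k → + ∣ k ∣ ≤ Δ P x̂) (eval-x̂ X Y Z) (∣eval∣-≤-Δ x̂ d-chord))
                        Δx≤Δz
    ; ∣Y∣≤Δz  = ≤-trans (subst (λ k → + ∣ k ∣ ≤ Δ P ŷ) (eval-ŷ X Y Z) (∣eval∣-≤-Δ ŷ d-chord))
                        Δy≤Δz
    ; Z≤Δz    = subst (_≤ Δ P ẑ) (eval-ẑ X Y Z) (eval-≤-Δ ẑ d-chord)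
    ; Δz≤span = subst (Δ P ẑ ≤_)
                      (trans (sym d-attains) (cong (_+_ (m * X + n * Y)) (*-identityˡ Z)))
                      (Δz≤Δ[m,n,1] m n)
    ; eval≤Δ  = λ f → eval-≤-Δ f d-chord
    }

  rounding-case : ∀ {a b m n} {c r₁ r₂ : ℕ} → ∣ + c * m - a ∣ ≡ r₁ → ∣ + c * n - b ∣ ≡ r₂ →
    r₁ ℕ.+ r₂ ℕ.< c → Δ P ẑ ≤ Δ P (a , b , + c)
  rounding-case {a} {b} {m} {n} {c} dist₁ dist₂ r₁+r₂<c =
    rounding-bound dist₁ dist₂ r₁+r₂<c ∣X∣≤Δz ∣Y∣≤Δz Δz≤span (eval≤Δ (a , b , + c))
    where open WidestChord (widestChord m n)

  odd-case : ∀ {a b} → SignedOdd a → SignedOdd b → ¬ (∣ a ∣ ≡ 1 × ∣ b ∣ ≡ 1) →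
    Δ P ẑ ≤ Δ P (a , b , + 2)
  odd-case (signedOdd {ε₁} ε₁-unit M) (signedOdd {ε₂} ε₂-unit N) ¬units =
    odd-bound {M} {N} {ε₁ * X} {ε₂ * Y} (¬units⇒0<M+N ε₁-unit ε₂-unit M N ¬units)
      (unit-bound ε₁-unit X ∣X∣≤Δz) (unit-bound ε₂-unit Y ∣Y∣≤Δz) Z≤Δz
      (≤-trans Δz≤span (≤-reflexive (pull-m ε₁ ε₂ (+ M) (+ N) X Y Z)))
      (≤-trans (≤-reflexive (pull-a ε₁ ε₂ (+ M) (+ N) X Y Z))
                (eval≤Δ (ε₁ * (+ 2 * + M + + 1) , ε₂ * (+ 2 * + N + + 1) , + 2)))
    where
    open WidestChord (widestChord (ε₁ * + M) (ε₂ * + N))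
    unit-bound : ∀ {ε} → IsUnit ε → ∀ X → + ∣ X ∣ ≤ Δ P ẑ → + ∣ ε * X ∣ ≤ Δ P ẑ
    unit-bound ε-unit X = subst (λ k → + k ≤ Δ P ẑ) (sym (∣ε*i∣≡∣i∣ ε-unit X))
    pull-m : ∀ ε₁ ε₂ M N X Y Z →
      ε₁ * M * X + ε₂ * N * Y + Z ≡ M * (ε₁ * X) + N * (ε₂ * Y) + Z
    pull-m = solve-∀
    pull-a : ∀ ε₁ ε₂ M N X Y Z →
      (+ 2 * M + + 1) * (ε₁ * X) + (+ 2 * N + + 1) * (ε₂ * Y) + + 2 * Z ≡
      ε₁ * (+ 2 * M + + 1) * X + ε₂ * (+ 2 * N + + 1) * Y + + 2 * Z
    pull-a = solve-∀

  width-bound : ∀ a b c .{{_ : NonZero c}} → Primitive (a , b , + c) →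
    ¬ Exceptional (a , b , + c) → Δ P ẑ ≤ Δ P (a , b , + c)
  width-bound a b c prim ¬exceptional
    with nearest-multiple a c | nearest-multiple b c
  ... | m , r₁ , dist₁ , 2r₁≤c | n , r₂ , dist₂ , 2r₂≤c with r₁ ℕ.+ r₂ ℕ.<? c
  ...   | yes r₁+r₂<c = rounding-case dist₁ dist₂ r₁+r₂<c
  ...   | no  r₁+r₂≮c with balanced-rounding {c} {r₁} {r₂} 2r₁≤c 2r₂≤c (ℕ.≮⇒≥ r₁+r₂≮c)
  ...     | refl , refl with balanced-primitive⇒r≡1 m n a b dist₁ dist₂ prim
  ...       | refl = odd-case (∣2m-a∣≡1⇒signedOdd m a dist₁) (∣2m-a∣≡1⇒signedOdd n b dist₂)
                       (λ (∣a∣≡1 , ∣b∣≡1) → ¬exceptional (∣a∣≡1 , ∣b∣≡1 , refl))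

mainTheorem4 : (P : LatticePolytope) →
    Δ P (+ 1 , + 0 , + 0) ≤ Δ P (+ 0 , + 1 , + 0) →
    Δ P (+ 0 , + 1 , + 0) ≤ Δ P (+ 0 , + 0 , + 1) →
    ((m n : ℤ) → Δ P (+ 0 , + 0 , + 1) ≤ Δ P (m , n , + 1)) →
    (a b c : ℤ) → Primitive (a , b , c) → c ≢ + 0 →
    ¬ (∣ a ∣ ≡ 1 × ∣ b ∣ ≡ 1 × ∣ c ∣ ≡ 2) →
    Δ P (+ 0 , + 0 , + 1) ≤ Δ P (a , b , c)
mainTheorem4 P Δx≤Δy Δy≤Δz Δz≤Δ[m,n,1] a b (+ 0) _ c≢0 _ = ⊥-elim (c≢0 refl)
mainTheorem4 P Δx≤Δy Δy≤Δz Δz≤Δ[m,n,1] a b +[1+ k ] prim _ ¬exceptional =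
  width-bound P (≤-trans Δx≤Δy Δy≤Δz) Δy≤Δz Δz≤Δ[m,n,1] a b (suc k) prim ¬exceptional
mainTheorem4 P Δx≤Δy Δy≤Δz Δz≤Δ[m,n,1] a b -[1+ k ] prim _ ¬exceptional = begin
  Δ P ẑ           ≤⟨ width-bound P (≤-trans Δx≤Δy Δy≤Δz) Δy≤Δz Δz≤Δ[m,n,1] (- a) (- b) (suc k)
                       (Primitive-negate f prim) (¬exceptional ∘ Exceptional-negate f) ⟩
  Δ P (negate f)  ≤⟨ Δ-negate-≤ P f ⟩
  Δ P f           ∎
  where
  open ≤-Reasoning
  f : Dir
  f = a , b , -[1+ k ]
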